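{- For every integer $n \ge 3$, the reverse permutation $R_n = (n, n-1, \ldots, 2, 1)$ can be transformed into the identity permutation $I_n = (1,2,\ldots,n)$ by a sequence of $J'(n)$ LRE moves, where $J'(3)=2$, $J'(4)=4$, $J'(5)=8$, $J'(6)=13$, $J'(7)=20$, and for $n \ge 8$, $J'(n) = \frac{3n^2-20n+72}{4}$ if $n$ is even and $J'(n) = \frac{3n^2-20n+73}{4}$ if $n$ is odd. In particular, at most $\frac{3}{4}n^2$ LRE moves suffice to sort $R_n$.
   Context: Permutations of $\{1,\ldots,n\}$ are written as sequences $(a_1,\ldots,a_n)$. The LRE moves are: $L$ (left rotate), $(a_1,\ldots,a_n)\mapsto(a_2,\ldots,a_n,a_1)$; $R$ (right rotate), $(a_1,\ldots,a_n)\mapsto(a_n,a_1,\ldots,a_{n-1})$; $E$ (exchange), $(a_1,a_2,a_3,\ldots,a_n)\mapsto(a_2,a_1,a_3,\ldots,a_n)$. Moves are applied one after another. -}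

module Defs where

open import Data.Nat using (ℕ; zero; suc; _+_; _*_; _∸_; _/_; _%_)
open import Data.List using (List; []; _∷_; _++_; [_]; foldl; reverse; applyUpTo)

data Move : Set where
  L R E : Move

rotL : {A : Set} → List A → List A
rotL []       = []
rotL (x ∷ xs) = xs ++ [ x ]

-- R: (a1,...,an) ↦ (an,a1,...,a(n-1))
rotR : {A : Set} → List A → List A
rotR []           = []
rotR (x ∷ [])     = x ∷ []
rotR (x ∷ y ∷ xs) with rotR (y ∷ xs)
... | []     = x ∷ []
... | z ∷ zs = z ∷ x ∷ zs

exch : {A : Set} → List A → List A
exch (x ∷ y ∷ xs) = y ∷ x ∷ xs
exch xs           = xs

applyMove : {A : Set} → Move → List A → List A
applyMove L = rotL
applyMove R = rotR
applyMove E = exch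

applyMoves : {A : Set} → List Move → List A → List A
applyMoves ms p = foldl (λ q m → applyMove m q) p ms

identityPerm : ℕ → List ℕ
identityPerm n = applyUpTo suc n

reversePerm : ℕ → List ℕ
reversePerm n = reverse (identityPerm n)

J′ : ℕ → ℕ
J′ 3 = 2
J′ 4 = 4
J′ 5 = 8
J′ 6 = 13
J′ 7 = 20
J′ n with n % 2
... | 0 = (3 * n * n + 72 ∸ 20 * n) / 4
... | _ = (3 * n * n + 73 ∸ 20 * n) / 4

-- Since R_n is the reverse of I_n, it suffices to reverse an arbitrary list. Cut it into two
-- blocks P ++ Q, each of the shape U ++ C ++ V with |U| = |V| = m and |C| ≤ 1. Below a fixed
-- head the pairs EL and RE rotate the tail left and right; with them, hop |M| sends
-- x ∷ M ++ y ∷ B to M ++ x ∷ B ++ [ y ]. Iterating hop m times (peel) turns U ++ C ++ V ++ B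
-- into C ++ rev U ++ B ++ rev V, so |C| + m left rotations give B ++ rev P; doing the same to Q
-- and finishing with m right rotations gives rev Q ++ rev P. This costs about n²/2 moves, which
-- for n ≥ 12 is at most J′ n and of the same parity, so EE pairs pad it to exactly J′ n.

module Submission where

open import Defs
open import Data.Nat using (ℕ; _≤_; _*_)
open import Data.List using (List; length)
open import Data.Product using (Σ; _×_)
open import Relation.Binary.PropositionalEquality using (_≡_)

open import Data.Nat using (zero; suc; _+_; _∸_; _/_; _%_; z≤n; s≤s; s≤s⁻¹)
open import Data.Nat.Properties
  using (+-assoc; +-comm; *-comm; *-identityʳ; *-assoc; suc-injective; m+n∸m≡n; m+n∸n≡m; ≤-refl; ≤-trans; m≤m+n; +-monoʳ-≤; *-monoʳ-≤; ∸-monoʳ-≤; ≤ᵇ⇒≤; module ≤-Reasoning)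
open import Data.Nat.DivMod using (m*n/n≡m; m/n*n≤m; m%n<n; [m+kn]%n≡m%n)
open import Data.Nat.Tactic.RingSolver using (solve-∀; solve)
open import Data.List using ([]; _∷_; _++_; [_]; _∷ʳ_; reverse)
open import Data.List.Properties
  using (foldl-++; ++-assoc; ++-identityʳ; length-++; reverse-++; reverse-involutive; length-reverse; unfold-reverse; length-applyUpTo)
open import Data.List.Reverse using (Reverse; []; _∶_∶ʳ_; reverseView)
open import Data.Product using (_,_; ∃-syntax)
open import Data.Unit using (tt)
open import Relation.Binary.PropositionalEquality using (refl; sym; trans; cong; cong₂; subst; module ≡-Reasoning)

applyMoves-++ : {A : Set} (ms ns : List Move) (p : List A) →
                applyMoves (ms ++ ns) p ≡ applyMoves ns (applyMoves ms p)
applyMoves-++ ms ns p = foldl-++ (λ q m → applyMove m q) p ms ns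

infixr 8 _^_

_^_ : List Move → ℕ → List Move
w ^ zero  = []
w ^ suc k = w ++ w ^ k

length-^ : ∀ w k → length (w ^ k) ≡ k * length w
length-^ w zero    = refl
length-^ w (suc k) = trans (length-++ w) (cong (length w +_) (length-^ w k))

hop : ℕ → List Move
hop k = (E ∷ L ∷ []) ^ k ++ E ∷ (R ∷ E ∷ []) ^ k ++ [ L ]

peel : ℕ → ℕ → List Move
peel zero    c = []
peel (suc m) c = hop (m + c + m) ++ peel m c

reversal : ℕ → ℕ → ℕ → ℕ → List Move
reversal m₁ c₁ m₂ c₂ = (peel m₁ c₁ ++ [ L ] ^ (c₁ + m₁)) ++ (peel m₂ c₂ ++ [ R ] ^ m₂)

module _ {A : Set} where
  open ≡-Reasoning

  rotR-∷ʳ : ∀ (xs : List A) x → rotR (xs ∷ʳ x) ≡ x ∷ xs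
  rotR-∷ʳ []           z = refl
  rotR-∷ʳ (x ∷ [])     z = refl
  rotR-∷ʳ (x ∷ y ∷ xs) z with rotR (y ∷ xs ∷ʳ z) | rotR-∷ʳ (y ∷ xs) z
  ... | .(z ∷ y ∷ xs) | refl = refl

  L^-rotates : ∀ (xs ys : List A) → applyMoves ([ L ] ^ length xs) (xs ++ ys) ≡ ys ++ xs
  L^-rotates []       ys = sym (++-identityʳ ys)
  L^-rotates (x ∷ xs) ys = begin
    applyMoves ([ L ] ^ length xs) ((xs ++ ys) ∷ʳ x) ≡⟨ cong (applyMoves ([ L ] ^ length xs)) (++-assoc xs ys [ x ]) ⟩
    applyMoves ([ L ] ^ length xs) (xs ++ ys ∷ʳ x)   ≡⟨ L^-rotates xs (ys ∷ʳ x) ⟩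
    (ys ∷ʳ x) ++ xs                                  ≡⟨ ++-assoc ys [ x ] xs ⟩
    ys ++ x ∷ xs                                     ∎

  length-∷ʳ : ∀ (xs : List A) x → length (xs ∷ʳ x) ≡ suc (length xs)
  length-∷ʳ xs x = trans (length-++ xs) (+-comm (length xs) 1)

  R^-rotates : ∀ (xs ys : List A) → applyMoves ([ R ] ^ length ys) (xs ++ ys) ≡ ys ++ xs
  R^-rotates xs ys = go xs (reverseView ys)
    where
    go : ∀ xs {ys} → Reverse ys → applyMoves ([ R ] ^ length ys) (xs ++ ys) ≡ ys ++ xs
    go xs [] = ++-identityʳ xs
    go xs (ys ∶ v ∶ʳ y) = begin
      applyMoves ([ R ] ^ length (ys ∷ʳ y)) (xs ++ ys ∷ʳ y)  ≡⟨ cong (λ k → applyMoves ([ R ] ^ k) (xs ++ ys ∷ʳ y)) (length-∷ʳ ys y) ⟩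
      applyMoves ([ R ] ^ length ys) (rotR (xs ++ ys ∷ʳ y))  ≡⟨ cong (λ zs → applyMoves ([ R ] ^ length ys) (rotR zs)) (sym (++-assoc xs ys [ y ])) ⟩
      applyMoves ([ R ] ^ length ys) (rotR ((xs ++ ys) ∷ʳ y)) ≡⟨ cong (applyMoves ([ R ] ^ length ys)) (rotR-∷ʳ (xs ++ ys) y) ⟩
      applyMoves ([ R ] ^ length ys) (y ∷ xs ++ ys)         ≡⟨ go (y ∷ xs) v ⟩
      ys ++ y ∷ xs                                          ≡⟨ sym (++-assoc ys [ y ] xs) ⟩
      (ys ∷ʳ y) ++ xs                                       ∎

  EL-rotates-tail : ∀ (a : A) t → applyMoves (E ∷ L ∷ []) (a ∷ t) ≡ a ∷ rotL t
  EL-rotates-tail a []      = refl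
  EL-rotates-tail a (x ∷ t) = refl

  RE-rotates-tail : ∀ (a : A) t → applyMoves (R ∷ E ∷ []) (a ∷ t) ≡ a ∷ rotR t
  RE-rotates-tail a []      = refl
  RE-rotates-tail a (x ∷ t) with rotR (x ∷ t)
  ... | []     = refl
  ... | z ∷ zs = refl

  ^-fixes-head : ∀ {w v} (a : A) → (∀ t → applyMoves w (a ∷ t) ≡ a ∷ applyMoves v t) →
                 ∀ k t → applyMoves (w ^ k) (a ∷ t) ≡ a ∷ applyMoves (v ^ k) t
  ^-fixes-head         a act zero    t = refl
  ^-fixes-head {w} {v} a act (suc k) t = begin
    applyMoves (w ++ w ^ k) (a ∷ t)          ≡⟨ applyMoves-++ w (w ^ k) (a ∷ t) ⟩
    applyMoves (w ^ k) (applyMoves w (a ∷ t)) ≡⟨ cong (applyMoves (w ^ k)) (act t) ⟩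
    applyMoves (w ^ k) (a ∷ applyMoves v t)   ≡⟨ ^-fixes-head a act k (applyMoves v t) ⟩
    a ∷ applyMoves (v ^ k) (applyMoves v t)   ≡⟨ cong (a ∷_) (sym (applyMoves-++ v (v ^ k) t)) ⟩
    a ∷ applyMoves (v ^ suc k) t              ∎

  carry-right : ∀ (a : A) M N → applyMoves ((E ∷ L ∷ []) ^ length M) (a ∷ M ++ N) ≡ a ∷ N ++ M
  carry-right a M N = trans (^-fixes-head a (EL-rotates-tail a) (length M) (M ++ N)) (cong (a ∷_) (L^-rotates M N))

  carry-left : ∀ (a : A) M N → applyMoves ((R ∷ E ∷ []) ^ length M) (a ∷ N ++ M) ≡ a ∷ M ++ N
  carry-left a M N = trans (^-fixes-head a (RE-rotates-tail a) (length M) (N ++ M)) (cong (a ∷_) (R^-rotates N M))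

  applyMoves-hop : ∀ (x y : A) M B → applyMoves (hop (length M)) (x ∷ M ++ y ∷ B) ≡ M ++ x ∷ B ++ [ y ]
  applyMoves-hop x y M B = begin
    applyMoves (hop k) (x ∷ M ++ y ∷ B)
      ≡⟨ applyMoves-++ ((E ∷ L ∷ []) ^ k) _ _ ⟩
    applyMoves (E ∷ (R ∷ E ∷ []) ^ k ++ [ L ]) (applyMoves ((E ∷ L ∷ []) ^ k) (x ∷ M ++ y ∷ B))
      ≡⟨ cong (applyMoves (E ∷ (R ∷ E ∷ []) ^ k ++ [ L ])) (carry-right x M (y ∷ B)) ⟩
    applyMoves ((R ∷ E ∷ []) ^ k ++ [ L ]) (y ∷ (x ∷ B) ++ M)
      ≡⟨ applyMoves-++ ((R ∷ E ∷ []) ^ k) _ _ ⟩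
    rotL (applyMoves ((R ∷ E ∷ []) ^ k) (y ∷ (x ∷ B) ++ M))
      ≡⟨ cong rotL (carry-left y M (x ∷ B)) ⟩
    (M ++ x ∷ B) ∷ʳ y
      ≡⟨ ++-assoc M (x ∷ B) [ y ] ⟩
    M ++ x ∷ B ++ [ y ] ∎
    where k = length M

  length-++₃ : ∀ (U C V : List A) → length (U ++ C ++ V) ≡ length U + (length C + length V)
  length-++₃ U C V = trans (length-++ U) (cong (length U +_) (length-++ C))

  ++-assoc₃ : ∀ (U C V W : List A) → (U ++ C ++ V) ++ W ≡ U ++ C ++ V ++ W
  ++-assoc₃ U C V W = trans (++-assoc U (C ++ V) W) (cong (U ++_) (++-assoc C V W))

  applyMoves-peel : ∀ (U C V B : List A) → length V ≡ length U →
                    applyMoves (peel (length U) (length C)) (U ++ C ++ V ++ B) ≡ C ++ reverse U ++ B ++ reverse V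
  applyMoves-peel U C V B = go U B (reverseView V)
    where
    c = length C

    go : ∀ U B {V} → Reverse V → length V ≡ length U →
         applyMoves (peel (length U) c) (U ++ C ++ V ++ B) ≡ C ++ reverse U ++ B ++ reverse V
    go []      B []             _  = cong (C ++_) (sym (++-identityʳ B))
    go []      B (V ∶ _ ∶ʳ y)  eq with () ← trans (sym (length-∷ʳ V y)) eq
    go (x ∷ U) B []             ()
    go (x ∷ U) B (V ∶ v ∶ʳ y)  eq = begin
      applyMoves (hop (n + c + n) ++ peel n c) (x ∷ U ++ C ++ (V ∷ʳ y) ++ B)
        ≡⟨ applyMoves-++ (hop (n + c + n)) _ _ ⟩
      applyMoves (peel n c) (applyMoves (hop (n + c + n)) (x ∷ U ++ C ++ (V ∷ʳ y) ++ B))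
        ≡⟨ cong₂ (λ k zs → applyMoves (peel n c) (applyMoves (hop k) (x ∷ zs))) hop-index shift-y ⟩
      applyMoves (peel n c) (applyMoves (hop (length (U ++ C ++ V))) (x ∷ (U ++ C ++ V) ++ y ∷ B))
        ≡⟨ cong (applyMoves (peel n c)) (applyMoves-hop x y (U ++ C ++ V) B) ⟩
      applyMoves (peel n c) ((U ++ C ++ V) ++ x ∷ B ++ [ y ])
        ≡⟨ cong (applyMoves (peel n c)) (++-assoc₃ U C V _) ⟩
      applyMoves (peel n c) (U ++ C ++ V ++ x ∷ B ++ [ y ])
        ≡⟨ go U (x ∷ B ++ [ y ]) v |V|≡n ⟩
      C ++ reverse U ++ (x ∷ B ++ [ y ]) ++ reverse V
        ≡⟨ cong (C ++_) reverse-shift ⟩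
      C ++ reverse (x ∷ U) ++ B ++ reverse (V ∷ʳ y) ∎
      where
      n = length U
      |V|≡n : length V ≡ n
      |V|≡n = suc-injective (trans (sym (length-∷ʳ V y)) eq)
      hop-index : n + c + n ≡ length (U ++ C ++ V)
      hop-index = trans (+-assoc n c n) (sym (trans (length-++₃ U C V) (cong (λ k → n + (c + k)) |V|≡n)))
      shift-y : U ++ C ++ (V ∷ʳ y) ++ B ≡ (U ++ C ++ V) ++ y ∷ B
      shift-y = trans (cong (λ zs → U ++ C ++ zs) (++-assoc V [ y ] B)) (sym (++-assoc₃ U C V (y ∷ B)))
      reverse-shift : reverse U ++ (x ∷ B ++ [ y ]) ++ reverse V ≡ reverse (x ∷ U) ++ B ++ reverse (V ∷ʳ y)
      reverse-shift = begin
        reverse U ++ (x ∷ B ++ [ y ]) ++ reverse V ≡⟨ cong (λ zs → reverse U ++ x ∷ zs) (++-assoc B [ y ] (reverse V)) ⟩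
        reverse U ++ x ∷ B ++ y ∷ reverse V        ≡⟨ sym (++-assoc (reverse U) [ x ] _) ⟩
        (reverse U ∷ʳ x) ++ B ++ y ∷ reverse V     ≡⟨ cong₂ (λ us vs → us ++ B ++ vs) (sym (unfold-reverse x U)) (sym (reverse-++ V [ y ])) ⟩
        reverse (x ∷ U) ++ B ++ reverse (V ∷ʳ y)   ∎

  split-at : ∀ a b (xs : List A) → length xs ≡ a + b →
             ∃[ ys ] ∃[ zs ] xs ≡ ys ++ zs × length ys ≡ a × length zs ≡ b
  split-at zero    b xs       eq = [] , xs , refl , refl , eq
  split-at (suc a) b []       ()
  split-at (suc a) b (x ∷ xs) eq with ys , zs , refl , |ys| , |zs| ← split-at a b xs (suc-injective eq)
    = x ∷ ys , zs , refl , cong suc |ys| , |zs|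

  split-around : ∀ m c (P : List A) → length P ≡ m + c + m →
                 ∃[ U ] ∃[ C ] ∃[ V ] P ≡ U ++ C ++ V × length U ≡ m × length C ≡ c × length V ≡ m
  split-around m c P eq with UC , V , refl , |UC| , |V| ← split-at (m + c) m P eq
                        with U , C , refl , |U| , |C| ← split-at m c UC |UC|
    = U , C , V , ++-assoc U C V , |U| , |C| , |V|

  reverse-short : ∀ (C : List A) → length C ≤ 1 → reverse C ≡ C
  reverse-short []          _           = refl
  reverse-short (x ∷ [])    _           = refl
  reverse-short (x ∷ y ∷ C) (s≤s ())

  reverse-around : ∀ (U C V : List A) → reverse C ≡ C → reverse (U ++ C ++ V) ≡ reverse V ++ C ++ reverse U
  reverse-around U C V palindrome = begin
    reverse (U ++ C ++ V)                   ≡⟨ reverse-++ U (C ++ V) ⟩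
    reverse (C ++ V) ++ reverse U           ≡⟨ cong (_++ reverse U) (reverse-++ C V) ⟩
    (reverse V ++ reverse C) ++ reverse U   ≡⟨ ++-assoc (reverse V) (reverse C) (reverse U) ⟩
    reverse V ++ reverse C ++ reverse U     ≡⟨ cong (λ cs → reverse V ++ cs ++ reverse U) palindrome ⟩
    reverse V ++ C ++ reverse U             ∎

  peel-then-L : ∀ m c (P B : List A) → c ≤ 1 → length P ≡ m + c + m →
                applyMoves (peel m c ++ [ L ] ^ (c + m)) (P ++ B) ≡ B ++ reverse P
  peel-then-L m c P B c≤1 eq with U , C , V , refl , refl , refl , |V| ← split-around m c P eq = begin
    applyMoves (peel m′ c′ ++ [ L ] ^ (c′ + m′)) ((U ++ C ++ V) ++ B)
      ≡⟨ applyMoves-++ (peel m′ c′) _ _ ⟩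
    applyMoves ([ L ] ^ (c′ + m′)) (applyMoves (peel m′ c′) ((U ++ C ++ V) ++ B))
      ≡⟨ cong (λ zs → applyMoves ([ L ] ^ (c′ + m′)) (applyMoves (peel m′ c′) zs)) (++-assoc₃ U C V B) ⟩
    applyMoves ([ L ] ^ (c′ + m′)) (applyMoves (peel m′ c′) (U ++ C ++ V ++ B))
      ≡⟨ cong (applyMoves ([ L ] ^ (c′ + m′))) (applyMoves-peel U C V B |V|) ⟩
    applyMoves ([ L ] ^ (c′ + m′)) (C ++ reverse U ++ B ++ reverse V)
      ≡⟨ cong₂ (λ k zs → applyMoves ([ L ] ^ k) zs) rotation-length (sym (++-assoc C (reverse U) _)) ⟩
    applyMoves ([ L ] ^ length (C ++ reverse U)) ((C ++ reverse U) ++ B ++ reverse V)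
      ≡⟨ L^-rotates (C ++ reverse U) (B ++ reverse V) ⟩
    (B ++ reverse V) ++ C ++ reverse U
      ≡⟨ ++-assoc B (reverse V) _ ⟩
    B ++ reverse V ++ C ++ reverse U
      ≡⟨ cong (B ++_) (sym (reverse-around U C V (reverse-short C c≤1))) ⟩
    B ++ reverse (U ++ C ++ V) ∎
    where
    m′ = length U
    c′ = length C
    rotation-length : c′ + m′ ≡ length (C ++ reverse U)
    rotation-length = sym (trans (length-++ C) (cong (c′ +_) (length-reverse U)))

  peel-then-R : ∀ m c (P B : List A) → c ≤ 1 → length P ≡ m + c + m →
                applyMoves (peel m c ++ [ R ] ^ m) (P ++ B) ≡ reverse P ++ B
  peel-then-R m c P B c≤1 eq with U , C , V , refl , refl , refl , |V| ← split-around m c P eq = begin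
    applyMoves (peel m′ c′ ++ [ R ] ^ m′) ((U ++ C ++ V) ++ B)
      ≡⟨ applyMoves-++ (peel m′ c′) _ _ ⟩
    applyMoves ([ R ] ^ m′) (applyMoves (peel m′ c′) ((U ++ C ++ V) ++ B))
      ≡⟨ cong (λ zs → applyMoves ([ R ] ^ m′) (applyMoves (peel m′ c′) zs)) (++-assoc₃ U C V B) ⟩
    applyMoves ([ R ] ^ m′) (applyMoves (peel m′ c′) (U ++ C ++ V ++ B))
      ≡⟨ cong (applyMoves ([ R ] ^ m′)) (applyMoves-peel U C V B |V|) ⟩
    applyMoves ([ R ] ^ m′) (C ++ reverse U ++ B ++ reverse V)
      ≡⟨ cong₂ (λ k zs → applyMoves ([ R ] ^ k) zs) rotation-length (sym (++-assoc₃ C (reverse U) B (reverse V))) ⟩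
    applyMoves ([ R ] ^ length (reverse V)) ((C ++ reverse U ++ B) ++ reverse V)
      ≡⟨ R^-rotates (C ++ reverse U ++ B) (reverse V) ⟩
    reverse V ++ C ++ reverse U ++ B
      ≡⟨ sym (++-assoc₃ (reverse V) C (reverse U) B) ⟩
    (reverse V ++ C ++ reverse U) ++ B
      ≡⟨ cong (_++ B) (sym (reverse-around U C V (reverse-short C c≤1))) ⟩
    reverse (U ++ C ++ V) ++ B ∎
    where
    m′ = length U
    c′ = length C
    rotation-length : m′ ≡ length (reverse V)
    rotation-length = sym (trans (length-reverse V) |V|)

  applyMoves-reversal : ∀ m₁ c₁ m₂ c₂ → c₁ ≤ 1 → c₂ ≤ 1 → (xs : List A) →
                        length xs ≡ (m₁ + c₁ + m₁) + (m₂ + c₂ + m₂) →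
                        applyMoves (reversal m₁ c₁ m₂ c₂) xs ≡ reverse xs
  applyMoves-reversal m₁ c₁ m₂ c₂ c₁≤1 c₂≤1 xs eq
    with P , Q , refl , |P| , |Q| ← split-at (m₁ + c₁ + m₁) (m₂ + c₂ + m₂) xs eq = begin
    applyMoves (reversal m₁ c₁ m₂ c₂) (P ++ Q)
      ≡⟨ applyMoves-++ (peel m₁ c₁ ++ [ L ] ^ (c₁ + m₁)) _ (P ++ Q) ⟩
    applyMoves (peel m₂ c₂ ++ [ R ] ^ m₂) (applyMoves (peel m₁ c₁ ++ [ L ] ^ (c₁ + m₁)) (P ++ Q))
      ≡⟨ cong (applyMoves (peel m₂ c₂ ++ [ R ] ^ m₂)) (peel-then-L m₁ c₁ P Q c₁≤1 |P|) ⟩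
    applyMoves (peel m₂ c₂ ++ [ R ] ^ m₂) (Q ++ reverse P)
      ≡⟨ peel-then-R m₂ c₂ Q (reverse P) c₂≤1 |Q| ⟩
    reverse Q ++ reverse P
      ≡⟨ sym (reverse-++ P Q) ⟩
    reverse (P ++ Q) ∎

  exch-involutive : ∀ (xs : List A) → exch (exch xs) ≡ xs
  exch-involutive []          = refl
  exch-involutive (x ∷ [])    = refl
  exch-involutive (x ∷ y ∷ xs) = refl

  EE^-identity : ∀ p (xs : List A) → applyMoves ((E ∷ E ∷ []) ^ p) xs ≡ xs
  EE^-identity zero    xs = refl
  EE^-identity (suc p) xs = trans (EE^-identity p (exch (exch xs))) (exch-involutive xs)

length-singleton^ : ∀ m k → length ([ m ] ^ k) ≡ k
length-singleton^ m k = trans (length-^ [ m ] k) (*-identityʳ k)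

length-hop : ∀ k → length (hop k) ≡ 4 * k + 2
length-hop k = begin
  length ((E ∷ L ∷ []) ^ k ++ E ∷ (R ∷ E ∷ []) ^ k ++ [ L ])
    ≡⟨ length-++ ((E ∷ L ∷ []) ^ k) ⟩
  length ((E ∷ L ∷ []) ^ k) + suc (length ((R ∷ E ∷ []) ^ k ++ [ L ]))
    ≡⟨ cong₂ (λ i j → i + suc j) (length-^ (E ∷ L ∷ []) k) (trans (length-++ ((R ∷ E ∷ []) ^ k)) (cong (_+ 1) (length-^ (R ∷ E ∷ []) k))) ⟩
  k * 2 + suc (k * 2 + 1)
    ≡⟨ solve (k ∷ []) ⟩
  4 * k + 2 ∎
  where open ≡-Reasoning

length-peel : ∀ m c → length (peel (suc m) c) ≡ 2 * suc m * (2 * m + 2 * c + 1)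
length-peel zero    c = begin
  length (hop (c + 0) ++ [])      ≡⟨ length-++ (hop (c + 0)) ⟩
  length (hop (c + 0)) + 0        ≡⟨ cong (_+ 0) (length-hop (c + 0)) ⟩
  4 * (c + 0) + 2 + 0             ≡⟨ solve (c ∷ []) ⟩
  2 * 1 * (2 * 0 + 2 * c + 1)     ∎
  where open ≡-Reasoning
length-peel (suc m) c = begin
  length (hop (suc m + c + suc m) ++ peel (suc m) c)
    ≡⟨ length-++ (hop (suc m + c + suc m)) ⟩
  length (hop (suc m + c + suc m)) + length (peel (suc m) c)
    ≡⟨ cong₂ _+_ (length-hop (suc m + c + suc m)) (length-peel m c) ⟩
  4 * (suc m + c + suc m) + 2 + 2 * suc m * (2 * m + 2 * c + 1)
    ≡⟨ solve (m ∷ c ∷ []) ⟩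
  2 * suc (suc m) * (2 * suc m + 2 * c + 1) ∎
  where open ≡-Reasoning

length-reversal : ∀ a c₁ b c₂ → length (reversal (suc a) c₁ (suc b) c₂) ≡
  2 * suc a * (2 * a + 2 * c₁ + 1) + (c₁ + suc a) + (2 * suc b * (2 * b + 2 * c₂ + 1) + suc b)
length-reversal a c₁ b c₂ = begin
  length ((peel (suc a) c₁ ++ [ L ] ^ (c₁ + suc a)) ++ (peel (suc b) c₂ ++ [ R ] ^ suc b))
    ≡⟨ length-++ (peel (suc a) c₁ ++ [ L ] ^ (c₁ + suc a)) ⟩
  length (peel (suc a) c₁ ++ [ L ] ^ (c₁ + suc a)) + length (peel (suc b) c₂ ++ [ R ] ^ suc b)
    ≡⟨ cong₂ _+_ (length-++ (peel (suc a) c₁)) (length-++ (peel (suc b) c₂)) ⟩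
  length (peel (suc a) c₁) + length ([ L ] ^ (c₁ + suc a)) + (length (peel (suc b) c₂) + length ([ R ] ^ suc b))
    ≡⟨ cong₂ (λ i j → i + length ([ L ] ^ (c₁ + suc a)) + (j + length ([ R ] ^ suc b))) (length-peel a c₁) (length-peel b c₂) ⟩
  2 * suc a * (2 * a + 2 * c₁ + 1) + length ([ L ] ^ (c₁ + suc a)) + (2 * suc b * (2 * b + 2 * c₂ + 1) + length ([ R ] ^ suc b))
    ≡⟨ cong₂ (λ i j → 2 * suc a * (2 * a + 2 * c₁ + 1) + i + (2 * suc b * (2 * b + 2 * c₂ + 1) + j))
             (length-singleton^ L (c₁ + suc a)) (length-singleton^ R (suc b)) ⟩
  2 * suc a * (2 * a + 2 * c₁ + 1) + (c₁ + suc a) + (2 * suc b * (2 * b + 2 * c₂ + 1) + suc b) ∎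
  where open ≡-Reasoning

J′-≥8 : ∀ k → J′ (8 + k) ≡ (3 * (8 + k) * (8 + k) + (72 + (8 + k) % 2) ∸ 20 * (8 + k)) / 4
J′-≥8 k with (8 + k) % 2 | m%n<n (8 + k) 2
... | 0           | _              = refl
... | 1           | _              = refl
... | suc (suc _) | s≤s (s≤s ())

J′-≥8-solution : ∀ k ρ T → (8 + k) % 2 ≡ ρ →
                 3 * (8 + k) * (8 + k) + (72 + ρ) ≡ 20 * (8 + k) + 4 * T → J′ (8 + k) ≡ T
J′-≥8-solution k ρ T parity identity = begin
  J′ n                                         ≡⟨ J′-≥8 k ⟩
  (3 * n * n + (72 + n % 2) ∸ 20 * n) / 4      ≡⟨ cong (λ r → (3 * n * n + (72 + r) ∸ 20 * n) / 4) parity ⟩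
  (3 * n * n + (72 + ρ) ∸ 20 * n) / 4          ≡⟨ cong (λ x → (x ∸ 20 * n) / 4) identity ⟩
  (20 * n + 4 * T ∸ 20 * n) / 4                ≡⟨ cong (_/ 4) (trans (m+n∸m≡n (20 * n) (4 * T)) (*-comm 4 T)) ⟩
  T * 4 / 4                                    ≡⟨ m*n/n≡m T 4 ⟩
  T                                            ∎
  where
  open ≡-Reasoning
  n = 8 + k

J′-≥8-bound : ∀ k → 4 * J′ (8 + k) ≤ 3 * ((8 + k) * (8 + k))
J′-≥8-bound k = begin
  4 * J′ n                               ≡⟨ cong (4 *_) (J′-≥8 k) ⟩
  4 * (x / 4)                            ≡⟨ *-comm 4 (x / 4) ⟩
  x / 4 * 4                              ≤⟨ m/n*n≤m x 4 ⟩
  3 * n * n + (72 + ρ) ∸ 20 * n          ≤⟨ ∸-monoʳ-≤ (3 * n * n + (72 + ρ)) offset≤ ⟩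
  3 * n * n + (72 + ρ) ∸ (72 + ρ)        ≡⟨ m+n∸n≡m (3 * n * n) (72 + ρ) ⟩
  3 * n * n                              ≡⟨ *-assoc 3 n n ⟩
  3 * (n * n)                            ∎
  where
  open ≤-Reasoning
  n = 8 + k
  ρ = n % 2
  x = 3 * n * n + (72 + ρ) ∸ 20 * n
  offset≤ : 72 + ρ ≤ 20 * n
  offset≤ = ≤-trans (+-monoʳ-≤ 72 (s≤s⁻¹ (m%n<n n 2))) (≤-trans (m≤m+n 73 87) (*-monoʳ-≤ 20 (m≤m+n 8 k)))

SortsReverseIn : ℕ → ℕ → Set
SortsReverseIn n t = Σ (List Move) λ ms → (length ms ≡ t) × (applyMoves ms (reversePerm n) ≡ identityPerm n)

padded : ∀ {n t} p → SortsReverseIn n t → SortsReverseIn n (2 * p + t)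
padded {n} p (ms , |ms| , sorts) =
  (E ∷ E ∷ []) ^ p ++ ms ,
  trans (length-++ ((E ∷ E ∷ []) ^ p)) (cong₂ _+_ (trans (length-^ (E ∷ E ∷ []) p) (*-comm p 2)) |ms|) ,
  trans (applyMoves-++ ((E ∷ E ∷ []) ^ p) ms (reversePerm n))
        (trans (cong (applyMoves ms) (EE^-identity p (reversePerm n))) sorts)

length-reversePerm : ∀ n → length (reversePerm n) ≡ n
length-reversePerm n = trans (length-reverse (identityPerm n)) (length-applyUpTo suc n)

reversal-sorts : ∀ n m₁ c₁ m₂ c₂ → c₁ ≤ 1 → c₂ ≤ 1 → n ≡ (m₁ + c₁ + m₁) + (m₂ + c₂ + m₂) →
                 SortsReverseIn n (length (reversal m₁ c₁ m₂ c₂))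
reversal-sorts n m₁ c₁ m₂ c₂ c₁≤1 c₂≤1 size =
  reversal m₁ c₁ m₂ c₂ , refl ,
  trans (applyMoves-reversal m₁ c₁ m₂ c₂ c₁≤1 c₂≤1 (reversePerm n) (trans (length-reversePerm n) size))
        (reverse-involutive (identityPerm n))

sorts-≥8 : ∀ k a c₁ b c₂ p ρ → c₁ ≤ 1 → c₂ ≤ 1 → (8 + k) % 2 ≡ ρ →
           8 + k ≡ (suc a + c₁ + suc a) + (suc b + c₂ + suc b) →
           3 * (8 + k) * (8 + k) + (72 + ρ) ≡
             20 * (8 + k) + 4 * (2 * p + (2 * suc a * (2 * a + 2 * c₁ + 1) + (c₁ + suc a) + (2 * suc b * (2 * b + 2 * c₂ + 1) + suc b))) →
           SortsReverseIn (8 + k) (J′ (8 + k))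
sorts-≥8 k a c₁ b c₂ p ρ c₁≤1 c₂≤1 parity size identity =
  subst (SortsReverseIn (8 + k))
        (trans (cong (2 * p +_) (length-reversal a c₁ b c₂)) (sym (J′-≥8-solution k ρ _ parity identity)))
        (padded p (reversal-sorts (8 + k) (suc a) c₁ (suc b) c₂ c₁≤1 c₂≤1 size))

data Mod4View : ℕ → Set where
  4*_+0 : ∀ s → Mod4View (s * 4)
  4*_+1 : ∀ s → Mod4View (1 + s * 4)
  4*_+2 : ∀ s → Mod4View (2 + s * 4)
  4*_+3 : ∀ s → Mod4View (3 + s * 4)

mod4View : ∀ k → Mod4View k
mod4View 0 = 4* 0 +0
mod4View 1 = 4* 0 +1
mod4View 2 = 4* 0 +2
mod4View 3 = 4* 0 +3
mod4View (suc (suc (suc (suc k)))) with mod4View k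
... | 4* s +0 = 4* suc s +0
... | 4* s +1 = 4* suc s +1
... | 4* s +2 = 4* suc s +2
... | 4* s +3 = 4* suc s +3

parity-≥12 : ∀ r s → (12 + (r + s * 4)) % 2 ≡ r % 2
parity-≥12 r s = trans (cong (_% 2) (regroup r s)) ([m+kn]%n≡m%n r (6 + s * 2) 2)
  where
  regroup : ∀ r s → 12 + (r + s * 4) ≡ r + (6 + s * 2) * 2
  regroup = solve-∀

-- Two blocks of nearly equal size; the sixth argument is the number of EE pairs of padding.
sorts-≥12 : ∀ k → SortsReverseIn (12 + k) (J′ (12 + k))
sorts-≥12 k with mod4View k
... | 4* s +0 = sorts-≥8 (4 + s * 4) (2 + s) 0 (2 + s) 0 (2 * s * s + 3 * s) 0 z≤n z≤n
                  (parity-≥12 0 s) (solve (s ∷ [])) (solve (s ∷ []))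
... | 4* s +1 = sorts-≥8 (5 + s * 4) (2 + s) 0 (2 + s) 1 (2 * s * s + 4 * s + 1) 1 z≤n ≤-refl
                  (parity-≥12 1 s) (solve (s ∷ [])) (solve (s ∷ []))
... | 4* s +2 = sorts-≥8 (6 + s * 4) (2 + s) 1 (2 + s) 1 (2 * s * s + 5 * s + 2) 0 ≤-refl ≤-refl
                  (parity-≥12 2 s) (solve (s ∷ [])) (solve (s ∷ []))
... | 4* s +3 = sorts-≥8 (7 + s * 4) (2 + s) 1 (3 + s) 0 (2 * s * s + 6 * s + 3) 1 ≤-refl z≤n
                  (parity-≥12 3 s) (solve (s ∷ [])) (solve (s ∷ []))

-- Below n = 12 every two-block reversal is longer than J′ n, so explicit words are used.
sorts-reverse : ∀ n → 3 ≤ n → SortsReverseIn n (J′ n)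
sorts-reverse 1 (s≤s ())
sorts-reverse 2 (s≤s (s≤s ()))
sorts-reverse 3 _ = L ∷ E ∷ [] , refl , refl
sorts-reverse 4 _ = E ∷ L ∷ L ∷ E ∷ [] , refl , refl
sorts-reverse 5 _ = E ∷ L ∷ L ∷ E ∷ L ∷ E ∷ R ∷ E ∷ [] , refl , refl
sorts-reverse 6 _ = E ∷ L ∷ E ∷ R ∷ E ∷ L ∷ L ∷ L ∷ E ∷ L ∷ E ∷ R ∷ E ∷ [] , refl , refl
sorts-reverse 7 _ = E ∷ L ∷ E ∷ R ∷ E ∷ L ∷ L ∷ L ∷ E ∷ L ∷ E ∷ L ∷ E ∷ R ∷ E ∷ R ∷ E ∷ L ∷ E ∷ R ∷ [] , refl , refl
sorts-reverse 8 _ = E ∷ L ∷ E ∷ L ∷ E ∷ R ∷ E ∷ R ∷ E ∷ L ∷ E ∷ L ∷ L ∷ L ∷ E ∷ L ∷ E ∷ L ∷ E ∷ R ∷ E ∷ R ∷ E ∷ L ∷ E ∷ R ∷ [] , refl , refl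
sorts-reverse 9 _ = E ∷ L ∷ E ∷ L ∷ E ∷ R ∷ E ∷ R ∷ E ∷ L ∷ E ∷ L ∷ L ∷ L ∷ E ∷ L ∷ E ∷ L ∷ E ∷ L ∷ E ∷ R ∷ E ∷ R ∷ E ∷ R ∷ E ∷ L ∷ E ∷ L ∷ E ∷ R ∷ E ∷ R ∷ [] , refl , refl
sorts-reverse 10 _ = E ∷ L ∷ E ∷ L ∷ E ∷ L ∷ E ∷ R ∷ E ∷ R ∷ E ∷ R ∷ E ∷ L ∷ E ∷ L ∷ E ∷ R ∷ E ∷ L ∷ L ∷ L ∷ L ∷ E ∷ L ∷ E ∷ L ∷ E ∷ L ∷ E ∷ R ∷ E ∷ R ∷ E ∷ R ∷ E ∷ L ∷ E ∷ L ∷ E ∷ R ∷ E ∷ R ∷ [] , refl , refl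
sorts-reverse 11 _ = E ∷ L ∷ E ∷ L ∷ E ∷ L ∷ E ∷ R ∷ E ∷ R ∷ E ∷ R ∷ E ∷ L ∷ E ∷ L ∷ E ∷ R ∷ E ∷ L ∷ L ∷ L ∷ L ∷ E ∷ L ∷ E ∷ L ∷ E ∷ L ∷ E ∷ L ∷ E ∷ R ∷ E ∷ R ∷ E ∷ R ∷ E ∷ R ∷ E ∷ L ∷ E ∷ L ∷ E ∷ L ∷ E ∷ R ∷ E ∷ R ∷ E ∷ L ∷ E ∷ R ∷ R ∷ [] , refl , refl
sorts-reverse (suc (suc (suc (suc (suc (suc (suc (suc (suc (suc (suc (suc k)))))))))))) _ = sorts-≥12 k

J′-bound : ∀ n → 3 ≤ n → 4 * J′ n ≤ 3 * (n * n)
J′-bound 1 (s≤s ())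
J′-bound 2 (s≤s (s≤s ()))
J′-bound 3 _ = ≤ᵇ⇒≤ _ _ tt
J′-bound 4 _ = ≤ᵇ⇒≤ _ _ tt
J′-bound 5 _ = ≤ᵇ⇒≤ _ _ tt
J′-bound 6 _ = ≤ᵇ⇒≤ _ _ tt
J′-bound 7 _ = ≤ᵇ⇒≤ _ _ tt
J′-bound (suc (suc (suc (suc (suc (suc (suc (suc k)))))))) _ = J′-≥8-bound k

theorem2 : (n : ℕ) → 3 ≤ n →
    (Σ (List Move) λ ms → (length ms ≡ J′ n) × (applyMoves ms (reversePerm n) ≡ identityPerm n))
    × (4 * J′ n ≤ 3 * (n * n))
theorem2 n 3≤n = sorts-reverse n 3≤n , J′-bound n 3≤n
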